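{- Let $w_n$ denote the word $aabab(bbaaba)^n$ and put $m_0=2$, $m_1=3$, $m_2=3$, $m_3=3$, $m_4=4$, $m_5=4$. Then for every $n\ge 0$: $m(w_n)\le 2n+m_0$; $m(w_nb)\le 2n+m_1$; $m(w_nbb)\le 2n+m_2$; $m(w_nbba)\le 2n+m_3$; $m(w_nbbaa)\le 2n+m_4$; $m(w_nbbaab)\le 2n+m_5$.
   Context: Words are finite strings over the alphabet $\{a,b\}$, with concatenation as product; $u^n$ denotes the $n$-fold concatenation of $u$ (and $u^0$ is the empty word). A word $a_0\dots a_n$ is a palindrome if $a_i=a_{n-i}$ for all $i\le n$. For a nonempty word $w$, $m(w)$ is the minimal number of nonempty palindromes whose concatenation equals $w$. -}

module Defs where

open import Data.Nat using (ℕ; zero; suc; _≤_)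
open import Data.List using (List; []; _∷_; _++_; reverse; length; concat)
open import Data.List.Relation.Unary.All using (All)
open import Data.Product using (Σ; _×_; _,_)
open import Relation.Binary.PropositionalEquality using (_≡_; _≢_)

data Letter : Set where
  a b : Letter

Word : Set
Word = List Letter

_^^_ : Word → ℕ → Word
u ^^ zero = []
u ^^ suc n = u ++ (u ^^ n)

Palindrome : Word → Set
Palindrome w = reverse w ≡ w

NonemptyPalindrome : Word → Set
NonemptyPalindrome w = (w ≢ []) × Palindrome w

PalFactorization : Word → List Word → Set
PalFactorization w ps = All NonemptyPalindrome ps × (concat ps ≡ w)

-- m(w) ≡ k : k is the minimal number of nonempty palindromes whose
-- concatenation equals w
IsMinPal : Word → ℕ → Set
IsMinPal w k =
  (Σ (List Word) λ ps → PalFactorization w ps × (length ps ≡ k))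
  × (∀ ps → PalFactorization w ps → k ≤ length ps)

wn : ℕ → Word
wn n = (a ∷ a ∷ b ∷ a ∷ b ∷ []) ++ ((b ∷ b ∷ a ∷ a ∷ b ∷ a ∷ []) ^^ n)

-- A factorization of w into at most c nonempty palindromes bounds m(w) by c
-- ('minimal-≤'), and such factorizations concatenate with additive counts
-- ('factorizable-++').  So it suffices to exhibit factorizations.
--
-- The
-- words w_n bba and w_n bbaab are handled by a joint induction, each feeding
-- the other one step later ('step'):
--   w_{n+1} bba   = (w_n bbaab) · abba             (2n+4) + 1 = 2(n+1) + 3,
--   w_{n+1} bbaab = (w_n bba) · a · bab · baab     (2n+3) + 3 = 2(n+1) + 4.
-- Then w_{n+1} = (w_n bba) · aba, and the remaining three words are obtained
-- by appending one palindrome ('extend'):  w_n b = w_n · b,  w_n bb = w_n · bb,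
-- w_n bbaa = (w_n bba) · a.
module Submission where

open import Defs
open import Data.Nat using (ℕ; zero; suc; _+_; _*_; _≤_)
open import Data.Nat.Properties using (≤-trans; ≤-refl; +-assoc; +-mono-≤)
open import Data.Nat.Tactic.RingSolver using (solve-∀)
open import Data.List using (List; []; _∷_; _++_; length; concat; reverse)
open import Data.List.Properties using (++-assoc; ++-identityʳ; concat-++; length-++)
open import Data.List.Relation.Unary.All using ([]; _∷_)
open import Data.List.Relation.Unary.All.Properties using (++⁺)
open import Data.Product using (_×_; _,_; Σ)
open import Relation.Binary.PropositionalEquality
  using (_≡_; refl; sym; trans; cong; subst; subst₂; module ≡-Reasoning)

Factorizable : Word → ℕ → Set
Factorizable w c = Σ (List Word) λ ps → PalFactorization w ps × (length ps ≤ c)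

minimal-≤ : ∀ {w c} → Factorizable w c → ∀ k → IsMinPal w k → k ≤ c
minimal-≤ (ps , fact , len≤c) k (_ , minimal) = ≤-trans (minimal ps fact) len≤c

palindrome : (x : Letter) (xs : Word) → reverse (x ∷ xs) ≡ x ∷ xs →
             Factorizable (x ∷ xs) 1
palindrome x xs pal = (x ∷ xs) ∷ [] , (((λ ()) , pal) ∷ [] , ++-identityʳ (x ∷ xs)) , ≤-refl

factorizable-++ : ∀ {u v c d} → Factorizable u c → Factorizable v d →
                  Factorizable (u ++ v) (c + d)
factorizable-++ {u} {v} {c} {d} (ps , (pals , eq-u) , len-ps) (qs , (qals , eq-v) , len-qs) =
  ps ++ qs , (++⁺ pals qals , concat-eq) , length-bound
  where
  concat-eq : concat (ps ++ qs) ≡ u ++ v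
  concat-eq = trans (sym (concat-++ ps qs)) (subst₂ (λ x y → concat ps ++ concat qs ≡ x ++ y) eq-u eq-v refl)

  length-bound : length (ps ++ qs) ≤ c + d
  length-bound = subst (_≤ c + d) (sym (length-++ ps))
                       (+-mono-≤ len-ps len-qs)

cast : ∀ {w w' c c'} → w ≡ w' → c ≡ c' → Factorizable w c → Factorizable w' c'
cast refl refl f = f

^^-suc : ∀ (u : Word) n → u ^^ suc n ≡ (u ^^ n) ++ u
^^-suc u zero = ++-identityʳ u
^^-suc u (suc n) = trans (cong (u ++_) (^^-suc u n)) (sym (++-assoc u (u ^^ n) u))

block : Word
block = b ∷ b ∷ a ∷ a ∷ b ∷ a ∷ []

wn-suc : ∀ n → wn (suc n) ≡ wn n ++ block
wn-suc n = trans (cong ((a ∷ a ∷ b ∷ a ∷ b ∷ []) ++_) (^^-suc block n))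
                 (sym (++-assoc (a ∷ a ∷ b ∷ a ∷ b ∷ []) (block ^^ n) block))

extend : ∀ {w s t m c d} → Factorizable (w ++ s) (m + c) → Factorizable t d →
         Factorizable (w ++ (s ++ t)) (m + (c + d))
extend {w} {s} {t} {m} {c} {d} f g =
  cast (++-assoc w s t) (+-assoc m c d) (factorizable-++ f g)

double-suc : ∀ n e → 2 * n + (2 + e) ≡ 2 * suc n + e
double-suc = solve-∀

step : ∀ {n s s₁ t c d e} → block ++ s ≡ s₁ ++ t → c + d ≡ 2 + e →
       Factorizable (wn n ++ s₁) (2 * n + c) → Factorizable t d →
       Factorizable (wn (suc n) ++ s) (2 * suc n + e)
step {n} {s} {s₁} {t} {c} {d} {e} split count f g =
  cast (sym word-eq) (trans (cong (2 * n +_) count) (double-suc n e))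
       (extend {wn n} {s₁} {m = 2 * n} f g)
  where
  open ≡-Reasoning
  word-eq : wn (suc n) ++ s ≡ wn n ++ (s₁ ++ t)
  word-eq = begin
    wn (suc n) ++ s      ≡⟨ cong (_++ s) (wn-suc n) ⟩
    (wn n ++ block) ++ s ≡⟨ ++-assoc (wn n) block s ⟩
    wn n ++ (block ++ s) ≡⟨ cong (wn n ++_) split ⟩
    wn n ++ (s₁ ++ t)    ∎

bba-bbaab : ∀ n → Factorizable (wn n ++ (b ∷ b ∷ a ∷ [])) (2 * n + 3)
                × Factorizable (wn n ++ (b ∷ b ∷ a ∷ a ∷ b ∷ [])) (2 * n + 4)
bba-bbaab zero =
  -- aababbba = aa · b · abbba  and  aababbbaab = a · aba · bb · baab
  factorizable-++ (palindrome a (a ∷ []) refl)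
    (factorizable-++ (palindrome b [] refl) (palindrome a (b ∷ b ∷ b ∷ a ∷ []) refl)) ,
  factorizable-++ (palindrome a [] refl)
    (factorizable-++ (palindrome a (b ∷ a ∷ []) refl)
      (factorizable-++ (palindrome b (b ∷ []) refl) (palindrome b (a ∷ a ∷ b ∷ []) refl)))
bba-bbaab (suc n) with bba-bbaab n
... | bba , bbaab =
  step {n} {s₁ = b ∷ b ∷ a ∷ a ∷ b ∷ []} refl refl bbaab (palindrome a (b ∷ b ∷ a ∷ []) refl) ,
  step {n} {s₁ = b ∷ b ∷ a ∷ []} refl refl bba
    (factorizable-++ (palindrome a [] refl)
      (factorizable-++ (palindrome b (a ∷ b ∷ []) refl) (palindrome b (a ∷ a ∷ b ∷ []) refl)))

-- w_n with 2n + 2 pieces: w_0 = aa · bab, and w_{n+1} = (w_n bba) · aba.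
-- (Stated for w_n · [] so that 'step' and 'extend' apply uniformly.)
plain : ∀ n → Factorizable (wn n ++ []) (2 * n + 2)
plain zero = factorizable-++ (palindrome a (a ∷ []) refl) (palindrome b (a ∷ b ∷ []) refl)
plain (suc n) with bba-bbaab n
... | bba , _ = step {n} {s₁ = b ∷ b ∷ a ∷ []} refl refl bba (palindrome a (b ∷ a ∷ []) refl)

lemma2 : (n : ℕ) →
    (∀ k → IsMinPal (wn n) k → k ≤ 2 * n + 2) ×
    (∀ k → IsMinPal (wn n ++ (b ∷ [])) k → k ≤ 2 * n + 3) ×
    (∀ k → IsMinPal (wn n ++ (b ∷ b ∷ [])) k → k ≤ 2 * n + 3) ×
    (∀ k → IsMinPal (wn n ++ (b ∷ b ∷ a ∷ [])) k → k ≤ 2 * n + 3) ×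
    (∀ k → IsMinPal (wn n ++ (b ∷ b ∷ a ∷ a ∷ [])) k → k ≤ 2 * n + 4) ×
    (∀ k → IsMinPal (wn n ++ (b ∷ b ∷ a ∷ a ∷ b ∷ [])) k → k ≤ 2 * n + 4)
lemma2 n with bba-bbaab n
... | bba , bbaab =
  minimal-≤ (cast (++-identityʳ (wn n)) refl (plain n)) ,
  minimal-≤ (extend {wn n} {[]} {m = 2 * n} (plain n) (palindrome b [] refl)) ,
  minimal-≤ (extend {wn n} {[]} {m = 2 * n} (plain n) (palindrome b (b ∷ []) refl)) ,
  minimal-≤ bba ,
  minimal-≤ (extend {wn n} {b ∷ b ∷ a ∷ []} {m = 2 * n} bba (palindrome a [] refl)) ,
  minimal-≤ bbaab
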